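{- If $G$ is a connected graph of order $n \geq 4$ with $\gamma_R(G) = 3$, then $b_R(G) \leq \Delta(G) = n - 2$.
   Context: All graphs are finite and simple. A Roman dominating function on $G$ is a function $f: V(G) \to \{0,1,2\}$ such that every vertex $v$ with $f(v)=0$ has a neighbor $u$ with $f(u)=2$; its weight is $\sum_v f(v)$, and $\gamma_R(G)$ is the minimum weight of such a function. $\Delta(G)$ is the maximum degree. For a graph with maximum degree at least two, the Roman bondage number $b_R(G)$ is the minimum cardinality of a set $E' \subseteq E(G)$ with $\gamma_R(G - E') > \gamma_R(G)$, where $G-E'$ is obtained by deleting the edges of $E'$. -}

module Defs where

open import Data.Nat using (ℕ; zero; suc; _+_; _≤_; _<_; _⊔_; _<ᵇ_)
open import Data.Nat.ListAction using (sum)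
open import Data.Bool using (Bool; true; false; _∧_; not; if_then_else_)
open import Data.Fin using (Fin; toℕ)
open import Data.List using (List; map; foldr; allFin; cartesianProduct; filter; length)
open import Data.Product using (Σ; ∃; _×_; _,_; proj₁; proj₂)
open import Relation.Binary.PropositionalEquality using (_≡_)

record Graph (n : ℕ) : Set where
  field
    adj    : Fin n → Fin n → Bool
    sym    : ∀ i j → adj i j ≡ adj j i
    irrefl : ∀ i → adj i i ≡ false
open Graph public

b2n : Bool → ℕ
b2n true  = 1
b2n false = 0

degree : ∀ {n} → Graph n → Fin n → ℕ
degree {n} G v = sum (map (λ u → b2n (adj G v u)) (allFin n))

maxDegree : ∀ {n} → Graph n → ℕ
maxDegree {n} G = foldr _⊔_ 0 (map (degree G) (allFin n))

data Reach {n : ℕ} (G : Graph n) : Fin n → Fin n → Set where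
  here : ∀ {u} → Reach G u u
  step : ∀ {u w v} → adj G u w ≡ true → Reach G w v → Reach G u v

Connected : ∀ {n} → Graph n → Set
Connected {n} G = ∀ (u v : Fin n) → Reach G u v

IsRDF : ∀ {n} → Graph n → (Fin n → ℕ) → Set
IsRDF {n} G f =
  (∀ v → f v ≤ 2) ×
  (∀ v → f v ≡ 0 → ∃ λ (u : Fin n) → (adj G v u ≡ true) × (f u ≡ 2))

weight : ∀ {n} → (Fin n → ℕ) → ℕ
weight {n} f = sum (map f (allFin n))

IsRomanDomNumber : ∀ {n} → Graph n → ℕ → Set
IsRomanDomNumber {n} G k =
  (∃ λ (f : Fin n → ℕ) → IsRDF G f × (weight f ≡ k)) ×
  (∀ (f : Fin n → ℕ) → IsRDF G f → k ≤ weight f)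

record EdgeSubset {n : ℕ} (G : Graph n) : Set where
  field
    mem    : Fin n → Fin n → Bool
    memSym : ∀ i j → mem i j ≡ mem j i
    memSub : ∀ i j → mem i j ≡ true → adj G i j ≡ true
open EdgeSubset public

edgeCount : ∀ {n} {G : Graph n} → EdgeSubset G → ℕ
edgeCount {n} E =
  sum (map (λ p → if (toℕ (proj₁ p) <ᵇ toℕ (proj₂ p)) then b2n (mem E (proj₁ p) (proj₂ p)) else 0)
           (cartesianProduct (allFin n) (allFin n)))

deleteEdges : ∀ {n} (G : Graph n) → EdgeSubset G → Graph n
deleteEdges G E = record
  { adj    = λ i j → adj G i j ∧ not (mem E i j)
  ; sym    = λ i j → cong2 (λ a b → a ∧ not b) (Graph.sym G i j) (memSym E i j)
  ; irrefl = λ i → irr i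
  }
  where
    open import Relation.Binary.PropositionalEquality using (cong₂; cong)
    cong2 = cong₂
    irr : ∀ i → adj G i i ∧ not (mem E i i) ≡ false
    irr i = cong (λ a → a ∧ not (mem E i i)) (Graph.irrefl G i)

IsRomanBondageSet : ∀ {n} (G : Graph n) → EdgeSubset G → Set
IsRomanBondageSet G E =
  ∀ k k' → IsRomanDomNumber G k → IsRomanDomNumber (deleteEdges G E) k' → k < k'

IsRomanBondageNumber : ∀ {n} → Graph n → ℕ → Set
IsRomanBondageNumber G b =
  (∃ λ E → IsRomanBondageSet G E × (edgeCount E ≡ b)) ×
  (∀ E → IsRomanBondageSet G E → b ≤ edgeCount E)

-- In a graph on n ≥ 4 vertices, a Roman dominating function of weight at most 3 labels exactly one
-- vertex u with 2 (two such labels already weigh 4), so every vertex labelled 0 is a neighbour of u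
-- and the weight is at least n + 1 − deg u. Labelling a vertex v with 2, its neighbours with 0 and
-- all other vertices with 1 has weight n + 1 − deg v. Hence γ_R ≤ 3 exactly when some vertex has
-- degree at least n − 2; γ_R(G) = 3 forces Δ(G) = n − 2, and an edge set E is a Roman bondage set
-- of G iff G − E has no vertex of degree n − 2.
--
-- Let v have degree n − 2, let w be its unique non-neighbour and a one of its neighbours. Deleting
-- the n − 2 edges at v lowers the degree of every vertex except w, which already has degree at most
-- n − 3 unless it is adjacent to a; in that case delete wa instead of va. So n − 2 edges suffice,
-- and the minimum b_R(G) exists since the edge sets of G can be searched exhaustively.

module Submission where

open import Defs hiding (sym)
open import Level using (0ℓ)
open import Data.Nat using (ℕ; zero; suc; _+_; _∸_; _≤_; _<_; _⊔_; _<ᵇ_; z≤n; s≤s)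
open import Data.Nat.Properties as ℕ hiding (_≟_)
import Data.Nat.ListAction as List
open import Data.Nat.ListAction.Properties using (sum-++)
open import Algebra.Properties.CommutativeMonoid.Sum +-0-commutativeMonoid
  using (sum; sum-syntax; sum-cong-≗; ∑-distrib-+; sum-replicate-zero)
open import Data.Bool using (Bool; true; false; _∧_; _∨_; not; if_then_else_; T)
open import Data.Bool.Properties as Bool using (∨-comm; ∨-zeroʳ; ∧-identityʳ)
open import Data.Fin using (Fin; zero; suc; toℕ)
open import Data.Fin.Properties using (_≟_; all?)
open import Data.List using (List; []; _∷_; _++_; map; foldr; allFin; tabulate; cartesianProduct)
open import Data.List.Properties using (map-tabulate; map-++; map-∘)
open import Data.List.Relation.Unary.All as All using (All; []; _∷_)
import Data.List.Relation.Unary.All.Properties as All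
open import Data.List.Relation.Unary.Any using (here; there)
open import Data.List.Membership.Propositional using (_∈_)
open import Data.List.Membership.Propositional.Properties using (∈-map⁺; ∈-allFin)
open import Data.List.Extrema.Nat using (argmax; f[xs]≤f[argmax])
open import Data.Product using (∃; _×_; _,_; proj₁; proj₂)
open import Data.Empty using (⊥-elim)
open import Function using (_∘_; id; const; case_of_)
open import Relation.Nullary using (Dec; yes; no; does)
open import Relation.Nullary.Decidable using (dec-true; dec-false; _×-dec_; _→-dec_)
open import Relation.Unary using (Pred; Decidable)
open import Relation.Binary using (Rel; Reflexive; _Respects_)
open import Relation.Binary.PropositionalEquality

private
  variable
    n : ℕ

-- Finite sums

sum-allFin : (f : Fin n → ℕ) → List.sum (map f (allFin n)) ≡ sum f
sum-allFin {n} f = trans (cong List.sum (map-tabulate id f)) (sum-tabulate f)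
  where
  sum-tabulate : ∀ {n} (f : Fin n → ℕ) → List.sum (tabulate f) ≡ sum f
  sum-tabulate {zero}  f = refl
  sum-tabulate {suc n} f = cong (f zero +_) (sum-tabulate (f ∘ suc))

sum-mono-≤ : {f g : Fin n → ℕ} → (∀ i → f i ≤ g i) → sum f ≤ sum g
sum-mono-≤ {zero}  f≤g = z≤n
sum-mono-≤ {suc n} f≤g = +-mono-≤ (f≤g zero) (sum-mono-≤ (f≤g ∘ suc))

sum-const-1 : ∀ n → sum {n} (const 1) ≡ n
sum-const-1 zero    = refl
sum-const-1 (suc n) = cong suc (sum-const-1 n)

sum≤n : (f : Fin n → ℕ) → (∀ i → f i ≤ 1) → sum f ≤ n
sum≤n {n} f f≤1 = subst (sum f ≤_) (sum-const-1 n) (sum-mono-≤ f≤1)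

when : Bool → ℕ → ℕ
when b x = if b then x else 0

sum-when : (b : Bool) (h : Fin n → ℕ) → sum (λ x → when b (h x)) ≡ when b (sum h)
sum-when {n} true  h = refl
sum-when {n} false h = sum-replicate-zero n

sum-select : (c : Fin n) (h : Fin n → ℕ) → sum (λ x → when (does (x ≟ c)) (h x)) ≡ h c
sum-select {suc n} zero    h = trans (cong (h zero +_) (sum-replicate-zero n)) (+-identityʳ (h zero))
sum-select {suc n} (suc c) h = sum-select c (h ∘ suc)

b2n≤1 : ∀ b → b2n b ≤ 1
b2n≤1 true  = s≤s z≤n
b2n≤1 false = z≤n

δ : Fin n → Fin n → ℕ
δ c x = when (does (x ≟ c)) 1

sum-δ : (c : Fin n) → sum (δ c) ≡ 1
sum-δ c = sum-select c (const 1)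

sum-1+δ : (c : Fin n) → ∑[ z < n ] (1 + δ c z) ≡ suc n
sum-1+δ {n} c = begin
  ∑[ z < n ] (1 + δ c z)         ≡⟨ ∑-distrib-+ (const 1) (δ c) ⟩
  sum {n} (const 1) + sum (δ c)  ≡⟨ cong₂ _+_ (sum-const-1 n) (sum-δ c) ⟩
  n + 1                          ≡⟨ +-comm n 1 ⟩
  suc n                          ∎
  where open ≡-Reasoning

sum<n⇒∃≡0 : (f : Fin n → ℕ) → sum f < n → ∃ λ i → f i ≡ 0
sum<n⇒∃≡0 {suc n} f sum<n with f zero in eq
... | zero  = zero , eq
... | suc a = let i , fi≡0 = sum<n⇒∃≡0 (f ∘ suc) (+-cancelˡ-< (suc a) _ _ (<-≤-trans sum<n (s≤s (m≤n+m n a))))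
              in suc i , fi≡0

0<sum⇒∃>0 : (f : Fin n → ℕ) → 0 < sum f → ∃ λ i → 0 < f i
0<sum⇒∃>0 {suc n} f 0<sum with f zero in eq
... | suc a = zero , subst (0 <_) (sym eq) (s≤s z≤n)
... | zero  = let i , 0<fi = 0<sum⇒∃>0 (f ∘ suc) 0<sum in suc i , 0<fi

sum≥two-twos : (f : Fin n → ℕ) {y u : Fin n} → f y ≡ 2 → f u ≡ 2 → y ≢ u → 4 ≤ sum f
sum≥two-twos {n} f {y} {u} fy≡2 fu≡2 y≢u = begin
  4                                                            ≡⟨ cong₂ _+_ (sum-select y (const 2)) (sum-select u (const 2)) ⟨
  ∑[ z < n ] when (does (z ≟ y)) 2 + ∑[ z < n ] when (does (z ≟ u)) 2
                                                               ≡⟨ ∑-distrib-+ (λ z → when (does (z ≟ y)) 2) (λ z → when (does (z ≟ u)) 2) ⟨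
  ∑[ z < n ] (when (does (z ≟ y)) 2 + when (does (z ≟ u)) 2)  ≤⟨ sum-mono-≤ pointwise ⟩
  sum f                                                        ∎
  where
  open ≤-Reasoning
  pointwise : ∀ z → when (does (z ≟ y)) 2 + when (does (z ≟ u)) 2 ≤ f z
  pointwise z with z ≟ y | z ≟ u
  ... | yes refl | yes refl = ⊥-elim (y≢u refl)
  ... | yes refl | no _     = ≤-reflexive (sym fy≡2)
  ... | no _     | yes refl = ≤-reflexive (sym fu≡2)
  ... | no _     | no _     = z≤n

-- Counting edges

sum-cartesianProduct : {A B : Set} (xs : List A) (ys : List B) (t : A × B → ℕ) →
  List.sum (map t (cartesianProduct xs ys)) ≡ List.sum (map (λ x → List.sum (map (λ y → t (x , y)) ys)) xs)
sum-cartesianProduct []       ys t = refl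
sum-cartesianProduct (x ∷ xs) ys t = begin
  List.sum (map t (map (x ,_) ys ++ cartesianProduct xs ys))
    ≡⟨ cong List.sum (map-++ t (map (x ,_) ys) (cartesianProduct xs ys)) ⟩
  List.sum (map t (map (x ,_) ys) ++ map t (cartesianProduct xs ys))
    ≡⟨ sum-++ (map t (map (x ,_) ys)) (map t (cartesianProduct xs ys)) ⟩
  List.sum (map t (map (x ,_) ys)) + List.sum (map t (cartesianProduct xs ys))
    ≡⟨ cong₂ _+_ (cong List.sum (sym (map-∘ ys))) (sum-cartesianProduct xs ys t) ⟩
  List.sum (map (λ y → t (x , y)) ys) + List.sum (map (λ x → List.sum (map (λ y → t (x , y)) ys)) xs) ∎
  where open ≡-Reasoning

aboveDiagonal : (Fin n → Fin n → Bool) → Fin n → Fin n → ℕ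
aboveDiagonal m i j = when (toℕ i <ᵇ toℕ j) (b2n (m i j))

pairCount : (Fin n → Fin n → Bool) → ℕ
pairCount {n} m = ∑[ i < n ] ∑[ j < n ] aboveDiagonal m i j

edgeCount≡pairCount : {G : Graph n} (E : EdgeSubset G) → edgeCount E ≡ pairCount (mem E)
edgeCount≡pairCount {n} E = begin
  edgeCount E
    ≡⟨ sum-cartesianProduct (allFin n) (allFin n) (λ (i , j) → aboveDiagonal (mem E) i j) ⟩
  List.sum (map (λ i → List.sum (map (aboveDiagonal (mem E) i) (allFin n))) (allFin n))
    ≡⟨ sum-allFin (λ i → List.sum (map (aboveDiagonal (mem E) i) (allFin n))) ⟩
  ∑[ i < n ] List.sum (map (aboveDiagonal (mem E) i) (allFin n))
    ≡⟨ sum-cong-≗ (λ i → sum-allFin (aboveDiagonal (mem E) i)) ⟩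
  pairCount (mem E) ∎
  where open ≡-Reasoning

∑₂-distrib-+ : (f g : Fin n → Fin n → ℕ) →
  ∑[ i < n ] ∑[ j < n ] (f i j + g i j) ≡ ∑[ i < n ] ∑[ j < n ] f i j + ∑[ i < n ] ∑[ j < n ] g i j
∑₂-distrib-+ {n} f g = trans (sum-cong-≗ (λ i → ∑-distrib-+ (f i) (g i))) (∑-distrib-+ (λ i → ∑[ j < n ] f i j) (λ i → ∑[ j < n ] g i j))

∑₂-mono-≤ : {f g : Fin n → Fin n → ℕ} → (∀ i j → f i j ≤ g i j) →
  ∑[ i < n ] ∑[ j < n ] f i j ≤ ∑[ i < n ] ∑[ j < n ] g i j
∑₂-mono-≤ f≤g = sum-mono-≤ (λ i → sum-mono-≤ (f≤g i))

pairCount-∨ : (m₁ m₂ : Fin n → Fin n → Bool) →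
  pairCount (λ i j → m₁ i j ∨ m₂ i j) ≤ pairCount m₁ + pairCount m₂
pairCount-∨ m₁ m₂ = ≤-trans
  (∑₂-mono-≤ (λ i j → when-b2n-∨ (toℕ i <ᵇ toℕ j) (m₁ i j) (m₂ i j)))
  (≤-reflexive (∑₂-distrib-+ (aboveDiagonal m₁) (aboveDiagonal m₂)))
  where
  when-b2n-∨ : ∀ l a b → when l (b2n (a ∨ b)) ≤ when l (b2n a) + when l (b2n b)
  when-b2n-∨ false a     b     = z≤n
  when-b2n-∨ true  false b     = ≤-refl
  when-b2n-∨ true  true  false = ≤-refl
  when-b2n-∨ true  true  true  = s≤s z≤n

∨-introˡ : {a : Bool} (b : Bool) → a ≡ true → a ∨ b ≡ true
∨-introˡ b refl = refl

∨-introʳ : (a : Bool) {b : Bool} → b ≡ true → a ∨ b ≡ true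
∨-introʳ a refl = ∨-zeroʳ a

star : Fin n → (Fin n → Bool) → Fin n → Fin n → Bool
star c p i j = (does (i ≟ c) ∧ p j) ∨ (does (j ≟ c) ∧ p i)

star-sym : (c : Fin n) (p : Fin n → Bool) (i j : Fin n) → star c p i j ≡ star c p j i
star-sym c p i j = ∨-comm (does (i ≟ c) ∧ p j) (does (j ≟ c) ∧ p i)

star-centre : (c : Fin n) (p : Fin n → Bool) (j : Fin n) → p j ≡ true → star c p c j ≡ true
star-centre c p j pj rewrite dec-true (c ≟ c) refl | pj = refl

star-leaf : (c : Fin n) (p : Fin n → Bool) (i : Fin n) → p i ≡ true → star c p i c ≡ true
star-leaf c p i pi = trans (star-sym c p i c) (star-centre c p i pi)

pairCount-star : (c : Fin n) (p : Fin n → Bool) → pairCount (star c p) ≤ ∑[ x < n ] b2n (p x)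
pairCount-star {n} c p = begin
  pairCount (star c p)
    ≤⟨ ∑₂-mono-≤ (λ i j → aboveDiagonal-star (toℕ i <ᵇ toℕ j) (does (i ≟ c)) (does (j ≟ c)) (p j) (p i)) ⟩
  ∑[ i < n ] ∑[ j < n ] (when (does (i ≟ c)) (ordered i j (p j)) + when (does (j ≟ c)) (ordered i j (p i)))
    ≡⟨ ∑₂-distrib-+ (λ i j → when (does (i ≟ c)) (ordered i j (p j))) (λ i j → when (does (j ≟ c)) (ordered i j (p i))) ⟩
  ∑[ i < n ] ∑[ j < n ] when (does (i ≟ c)) (ordered i j (p j)) + ∑[ i < n ] ∑[ j < n ] when (does (j ≟ c)) (ordered i j (p i))
    ≡⟨ cong₂ _+_ (trans (sum-cong-≗ (λ i → sum-when (does (i ≟ c)) (λ j → ordered i j (p j))))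
                        (sum-select c (λ i → ∑[ j < n ] ordered i j (p j))))
                 (sum-cong-≗ (λ i → sum-select c (λ j → ordered i j (p i)))) ⟩
  ∑[ x < n ] ordered c x (p x) + ∑[ x < n ] ordered x c (p x)
    ≡⟨ sym (∑-distrib-+ (λ x → ordered c x (p x)) (λ x → ordered x c (p x))) ⟩
  ∑[ x < n ] (ordered c x (p x) + ordered x c (p x))
    ≤⟨ sum-mono-≤ (λ x → ordered-both-ways (toℕ c) (toℕ x) (p x)) ⟩
  ∑[ x < n ] b2n (p x) ∎
  where
  open ≤-Reasoning
  ordered : Fin n → Fin n → Bool → ℕ
  ordered i j q = when (toℕ i <ᵇ toℕ j) (b2n q)
  aboveDiagonal-star : ∀ l e₁ e₂ pj pi → when l (b2n ((e₁ ∧ pj) ∨ (e₂ ∧ pi))) ≤ when e₁ (when l (b2n pj)) + when e₂ (when l (b2n pi))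
  aboveDiagonal-star false e₁    e₂    pj    pi    = z≤n
  aboveDiagonal-star true  false false pj    pi    = z≤n
  aboveDiagonal-star true  false true  pj    pi    = ≤-refl
  aboveDiagonal-star true  true  false false pi    = z≤n
  aboveDiagonal-star true  true  false true  pi    = ≤-refl
  aboveDiagonal-star true  true  true  false pi    = ≤-refl
  aboveDiagonal-star true  true  true  true  pi    = s≤s z≤n
  ordered-both-ways : ∀ a b q → when (a <ᵇ b) (b2n q) + when (b <ᵇ a) (b2n q) ≤ b2n q
  ordered-both-ways a b q with a <ᵇ b in a<b | b <ᵇ a in b<a
  ... | false | false = z≤n
  ... | false | true  = ≤-refl
  ... | true  | false = ≤-reflexive (+-identityʳ (b2n q))
  ... | true  | true  = ⊥-elim (<-asym (<ᵇ⇒< a b (subst T (sym a<b) _)) (<ᵇ⇒< b a (subst T (sym b<a) _)))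

-- Exhaustive search

Searchable : (B : Set) → Rel B 0ℓ → Set₁
Searchable B _≈_ = (P : Pred B 0ℓ) → Decidable P → P Respects _≈_ → Dec (∃ P)

searchable-Bool : Searchable Bool _≡_
searchable-Bool P P? _ with P? true | P? false
... | yes Ptrue | _          = yes (true , Ptrue)
... | no _      | yes Pfalse = yes (false , Pfalse)
... | no ¬Ptrue | no ¬Pfalse = no λ { (true , Ptrue) → ¬Ptrue Ptrue ; (false , Pfalse) → ¬Pfalse Pfalse }

searchable-Fin→ : {B : Set} {_≈_ : Rel B 0ℓ} → Reflexive _≈_ → Searchable B _≈_ →
  ∀ k → Searchable (Fin k → B) (λ f g → ∀ i → f i ≈ g i)
searchable-Fin→ refl≈ search zero P P? resp with P? (λ ())
... | yes Pf = yes (_ , Pf)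
... | no ¬Pf = no λ (f , Pf) → ¬Pf (resp (λ ()) Pf)
searchable-Fin→ {B} {_≈_} refl≈ search (suc k) P P? resp with search Extends Extends? Extends-resp
  where
  _◂_ : B → (Fin k → B) → Fin (suc k) → B
  (b ◂ g) zero    = b
  (b ◂ g) (suc i) = g i
  Extends : Pred B 0ℓ
  Extends b = ∃ λ g → P (b ◂ g)
  Extends? : Decidable Extends
  Extends? b = searchable-Fin→ refl≈ search k (P ∘ (b ◂_)) (P? ∘ (b ◂_))
                 (λ g≈g′ → resp λ { zero → refl≈ ; (suc i) → g≈g′ i })
  Extends-resp : Extends Respects _≈_
  Extends-resp a≈b (g , P[a◂g]) = g , resp (λ { zero → a≈b ; (suc i) → refl≈ }) P[a◂g]
... | yes (b , g , P[b◂g]) = yes (_ , P[b◂g])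
... | no ¬Extends = no λ (f , Pf) → ¬Extends (f zero , f ∘ suc , resp (λ { zero → refl≈ ; (suc i) → refl≈ }) Pf)

∃-least : {Q : Pred ℕ 0ℓ} → Decidable Q → ∀ {c} → Q c → ∃ λ b → Q b × (∀ {m} → Q m → b ≤ m)
∃-least Q? {c} Qc with Q? 0
... | yes Q0 = 0 , Q0 , λ _ → z≤n
∃-least Q? {zero}  Q0 | no ¬Q0 = ⊥-elim (¬Q0 Q0)
∃-least Q? {suc c} Qc | no ¬Q0 with ∃-least (Q? ∘ suc) Qc
... | b , Qsb , least = suc b , Qsb , λ { {zero} Q0 → ⊥-elim (¬Q0 Q0) ; {suc m} Qsm → s≤s (least Qsm) }

-- Degrees

foldr-⊔-lub : {b : ℕ} {xs : List ℕ} → All (_≤ b) xs → foldr _⊔_ 0 xs ≤ b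
foldr-⊔-lub []         = z≤n
foldr-⊔-lub (x≤b ∷ xs≤b) = ⊔-lub x≤b (foldr-⊔-lub xs≤b)

foldr-⊔-ub : {x : ℕ} {xs : List ℕ} → x ∈ xs → x ≤ foldr _⊔_ 0 xs
foldr-⊔-ub (here refl) = m≤m⊔n _ _
foldr-⊔-ub {xs = y ∷ _} (there x∈xs) = ≤-trans (foldr-⊔-ub x∈xs) (m≤n⊔m y _)

module _ (G : Graph n) where

  maxDegree-lub : {b : ℕ} → (∀ u → degree G u ≤ b) → maxDegree G ≤ b
  maxDegree-lub deg≤b = foldr-⊔-lub (All.map⁺ (All.tabulate⁺ deg≤b))

  degree≤maxDegree : (u : Fin n) → degree G u ≤ maxDegree G
  degree≤maxDegree u = foldr-⊔-ub (∈-map⁺ (degree G) (∈-allFin u))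

  maximumDegreeVertex : Fin n → Fin n
  maximumDegreeVertex x = argmax (degree G) x (allFin n)

  degree≤maximumDegreeVertex : (x u : Fin n) → degree G u ≤ degree G (maximumDegreeVertex x)
  degree≤maximumDegreeVertex x u = All.lookup (f[xs]≤f[argmax] x (allFin n)) (∈-allFin u)

  degree≡sum : (u : Fin n) → degree G u ≡ ∑[ z < n ] b2n (adj G u z)
  degree≡sum u = sum-allFin (λ z → b2n (adj G u z))

  nonNeighbours⇒degree+2<n : {x p q : Fin n} → p ≢ q → x ≢ p → x ≢ q → adj G x p ≡ false → adj G x q ≡ false →
    degree G x + 2 < n
  nonNeighbours⇒degree+2<n {x} {p} {q} p≢q x≢p x≢q x≁p x≁q = begin
    suc (degree G x + 2)                                    ≡⟨ +-suc (degree G x) 2 ⟨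
    degree G x + 3                                          ≡⟨ cong₂ _+_ (degree≡sum x) (sym sum-δ₃) ⟩
    ∑[ z < n ] b2n (adj G x z) + ∑[ z < n ] δ₃ z            ≡⟨ ∑-distrib-+ (λ z → b2n (adj G x z)) δ₃ ⟨
    ∑[ z < n ] (b2n (adj G x z) + δ₃ z)                     ≤⟨ sum≤n _ pointwise ⟩
    n                                                       ∎
    where
    open ≤-Reasoning
    δ₃ : Fin n → ℕ
    δ₃ z = δ x z + δ p z + δ q z
    sum-δ₃ : sum δ₃ ≡ 3
    sum-δ₃ = begin-equality
      sum δ₃                                 ≡⟨ ∑-distrib-+ (λ z → δ x z + δ p z) (δ q) ⟩
      ∑[ z < n ] (δ x z + δ p z) + sum (δ q) ≡⟨ cong (_+ sum (δ q)) (∑-distrib-+ (δ x) (δ p)) ⟩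
      sum (δ x) + sum (δ p) + sum (δ q)      ≡⟨ cong₂ _+_ (cong₂ _+_ (sum-δ x) (sum-δ p)) (sum-δ q) ⟩
      3                                      ∎
    pointwise : ∀ z → b2n (adj G x z) + δ₃ z ≤ 1
    pointwise z with z ≟ x | z ≟ p | z ≟ q
    ... | yes refl | yes refl | _        = ⊥-elim (x≢p refl)
    ... | yes refl | no _     | yes refl = ⊥-elim (x≢q refl)
    ... | yes refl | no _     | no _     rewrite irrefl G z = ≤-refl
    ... | no _     | yes refl | yes refl = ⊥-elim (p≢q refl)
    ... | no _     | yes refl | no _     rewrite x≁p = ≤-refl
    ... | no _     | no _     | yes refl rewrite x≁q = ≤-refl
    ... | no _     | no _     | no _     = ≤-trans (≤-reflexive (+-identityʳ _)) (b2n≤1 (adj G x z))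

  degreeWithout : (Fin n → Fin n → Bool) → Fin n → ℕ
  degreeWithout m x = ∑[ u < n ] b2n (adj G x u ∧ not (m x u))

  degree-deleteEdges : (E : EdgeSubset G) (x : Fin n) → degree (deleteEdges G E) x ≡ degreeWithout (mem E) x
  degree-deleteEdges E x = sum-allFin (λ u → b2n (adj G x u ∧ not (mem E x u)))

  degreeWithout≤degree : (m : Fin n → Fin n → Bool) (x : Fin n) → degreeWithout m x ≤ degree G x
  degreeWithout≤degree m x = subst (degreeWithout m x ≤_) (sym (degree≡sum x)) (sum-mono-≤ (λ u → b2n-∧ (adj G x u) (not (m x u))))
    where
    b2n-∧ : ∀ a b → b2n (a ∧ b) ≤ b2n a
    b2n-∧ true  b = b2n≤1 b
    b2n-∧ false b = z≤n

  degreeWithout<degree : (m : Fin n → Fin n → Bool) {x y : Fin n} → m x y ≡ true → adj G x y ≡ true →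
    degreeWithout m x < degree G x
  degreeWithout<degree m {x} {y} mxy x~y = begin-strict
    degreeWithout m x                                   <⟨ m<m+n (degreeWithout m x) (s≤s z≤n) ⟩
    degreeWithout m x + 1                               ≡⟨ cong (degreeWithout m x +_) (sum-δ y) ⟨
    degreeWithout m x + sum (δ y)                       ≡⟨ ∑-distrib-+ (λ u → b2n (adj G x u ∧ not (m x u))) (δ y) ⟨
    ∑[ u < n ] (b2n (adj G x u ∧ not (m x u)) + δ y u)  ≤⟨ sum-mono-≤ pointwise ⟩
    ∑[ u < n ] b2n (adj G x u)                          ≡⟨ degree≡sum x ⟨
    degree G x                                          ∎
    where
    open ≤-Reasoning
    pointwise : ∀ u → b2n (adj G x u ∧ not (m x u)) + δ y u ≤ b2n (adj G x u)
    pointwise u with u ≟ y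
    ... | yes refl rewrite x~y | mxy = ≤-refl
    ... | no _ with adj G x u
    ...   | true  = ≤-trans (≤-reflexive (+-identityʳ _)) (b2n≤1 _)
    ...   | false = z≤n

  star-⊆ : (c : Fin n) (p : Fin n → Bool) → (∀ j → p j ≡ true → adj G c j ≡ true) →
    ∀ i j → star c p i j ≡ true → adj G i j ≡ true
  star-⊆ c p p⊆N i j ij∈star with i ≟ c | j ≟ c | p i in pi | p j in pj
  ... | yes refl | _        | _    | true = p⊆N j pj
  ... | _        | yes refl | true | _    = trans (Graph.sym G i j) (p⊆N i pi)

-- Roman domination numbers at most three

module RomanDomination (H : Graph n) where

  starRDF : (v : Fin n) → ∃ λ f → IsRDF H f × weight f + degree H v ≡ suc n
  starRDF v = f , (f≤2 , zero⇒two-neighbour) , weight+degree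
    where
    f : Fin n → ℕ
    f x = if does (x ≟ v) then 2 else if adj H v x then 0 else 1
    f≤2 : ∀ x → f x ≤ 2
    f≤2 x with x ≟ v
    ... | yes _ = ≤-refl
    ... | no _ with adj H v x
    ...   | true  = z≤n
    ...   | false = s≤s z≤n
    zero⇒two-neighbour : ∀ x → f x ≡ 0 → ∃ λ u → adj H x u ≡ true × f u ≡ 2
    zero⇒two-neighbour x fx≡0 with x ≟ v | adj H v x in v~x
    ... | no _ | true = v , trans (Graph.sym H x v) v~x , cong (λ b → if b then 2 else _) (dec-true (v ≟ v) refl)
    pointwise : ∀ z → f z + b2n (adj H v z) ≡ 1 + δ v z
    pointwise z with z ≟ v
    ... | yes refl rewrite irrefl H z = refl
    ... | no _ with adj H v z
    ...   | true  = refl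
    ...   | false = refl
    weight+degree : weight f + degree H v ≡ suc n
    weight+degree = begin
      weight f + degree H v                          ≡⟨ cong₂ _+_ (sum-allFin f) (degree≡sum H v) ⟩
      sum f + ∑[ z < n ] b2n (adj H v z)             ≡⟨ sym (∑-distrib-+ f (λ z → b2n (adj H v z))) ⟩
      ∑[ z < n ] (f z + b2n (adj H v z))             ≡⟨ sum-cong-≗ pointwise ⟩
      ∑[ z < n ] (1 + δ v z)                         ≡⟨ sum-1+δ v ⟩
      suc n                                          ∎
      where open ≡-Reasoning

  weight≤3⇒∃heavyVertex : 4 ≤ n → (f : Fin n → ℕ) → IsRDF H f → weight f ≤ 3 →
    ∃ λ u → suc n ≤ degree H u + weight f
  weight≤3⇒∃heavyVertex 4≤n f (f≤2 , zero⇒two-neighbour) w≤3 = u , (begin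
    suc n                                         ≡⟨ sum-1+δ u ⟨
    ∑[ z < n ] (1 + δ u z)                        ≤⟨ sum-mono-≤ pointwise ⟩
    ∑[ z < n ] (b2n (adj H u z) + f z)            ≡⟨ ∑-distrib-+ (λ z → b2n (adj H u z)) f ⟩
    ∑[ z < n ] b2n (adj H u z) + sum f            ≡⟨ cong₂ _+_ (degree≡sum H u) (sum-allFin f) ⟨
    degree H u + weight f                         ∎)
    where
    open ≤-Reasoning
    sum≤3 : sum f ≤ 3
    sum≤3 = subst (_≤ 3) (sum-allFin f) w≤3
    unguarded = sum<n⇒∃≡0 f (≤-<-trans sum≤3 4≤n)
    u = proj₁ (zero⇒two-neighbour (proj₁ unguarded) (proj₂ unguarded))
    fu≡2 : f u ≡ 2
    fu≡2 = proj₂ (proj₂ (zero⇒two-neighbour (proj₁ unguarded) (proj₂ unguarded)))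
    -- The only vertex labelled 2 is u, so every vertex labelled 0 is a neighbour of u.
    pointwise : ∀ z → 1 + δ u z ≤ b2n (adj H u z) + f z
    pointwise z with z ≟ u
    ... | yes refl rewrite irrefl H z | fu≡2 = ≤-refl
    ... | no _ with f z in fz
    ...   | suc a = ≤-trans (s≤s z≤n) (m≤n+m (suc a) _)
    ...   | zero with zero⇒two-neighbour z fz
    ...     | y , z~y , fy≡2 with y ≟ u
    ...       | yes refl rewrite Graph.sym H y z | z~y = ≤-refl
    ...       | no y≢u = ⊥-elim (<⇒≱ (s≤s sum≤3) (sum≥two-twos f fy≡2 fu≡2 y≢u))

  romanDomNumber-unique : {k k′ : ℕ} → IsRomanDomNumber H k → IsRomanDomNumber H k′ → k ≡ k′
  romanDomNumber-unique ((f , f-rdf , wf≡k) , k-min) ((g , g-rdf , wg≡k′) , k′-min) =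
    ≤-antisym (subst (_ ≤_) wg≡k′ (k-min g g-rdf)) (subst (_ ≤_) wf≡k (k′-min f f-rdf))

  romanDomNumber≤3⇒∃nearUniversal : 4 ≤ n → {k : ℕ} → IsRomanDomNumber H k → k ≤ 3 →
    ∃ λ u → n ≤ degree H u + 2
  romanDomNumber≤3⇒∃nearUniversal 4≤n ((f , f-rdf , wf≡k) , _) k≤3 =
    u , ≤-pred (≤-trans n<deg+w (≤-trans (+-monoʳ-≤ (degree H u) w≤3) (≤-reflexive (+-suc (degree H u) 2))))
    where
    w≤3 : weight f ≤ 3
    w≤3 = subst (_≤ 3) (sym wf≡k) k≤3
    heavy = weight≤3⇒∃heavyVertex 4≤n f f-rdf w≤3
    u = proj₁ heavy
    n<deg+w = proj₂ heavy

  -- In fact γ_R(H) = n + 1 − Δ(H), attained by starRDF at a vertex of maximum degree.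
  nearUniversal⇒romanDomNumber≤3 : 4 ≤ n → (x : Fin n) → n ≤ degree H x + 2 →
    ∃ λ k → IsRomanDomNumber H k × k ≤ 3
  nearUniversal⇒romanDomNumber≤3 4≤n x n≤deg+2 = suc n ∸ Δ , ((f , f-rdf , wf≡k) , minimal) , k≤3
    where
    v = maximumDegreeVertex H x
    Δ = degree H v
    n<Δ+3 : suc n ≤ Δ + 3
    n<Δ+3 = ≤-trans (s≤s (≤-trans n≤deg+2 (+-monoˡ-≤ 2 (degree≤maximumDegreeVertex H x x)))) (≤-reflexive (sym (+-suc Δ 2)))
    k≤3 : suc n ∸ Δ ≤ 3
    k≤3 = m≤n+o⇒m∸n≤o (suc n) Δ n<Δ+3
    f = proj₁ (starRDF v)
    f-rdf = proj₁ (proj₂ (starRDF v))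
    wf≡k : weight f ≡ suc n ∸ Δ
    wf≡k = trans (sym (m+n∸n≡m (weight f) Δ)) (cong (_∸ Δ) (proj₂ (proj₂ (starRDF v))))
    minimal : ∀ g → IsRDF H g → suc n ∸ Δ ≤ weight g
    minimal g g-rdf with weight g ≤? 3
    ... | no w≰3 = ≤-trans k≤3 (<⇒≤ (≰⇒> w≰3))
    ... | yes w≤3 with weight≤3⇒∃heavyVertex 4≤n g g-rdf w≤3
    ...   | u , n<deg+w = m≤n+o⇒m∸n≤o (suc n) Δ (≤-trans n<deg+w (+-monoˡ-≤ (weight g) (degree≤maximumDegreeVertex H x u)))

-- Roman bondage when γ_R = 3

module Bondage (G : Graph n) (4≤n : 4 ≤ n) (γ≡3 : IsRomanDomNumber G 3) where

  open RomanDomination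

  degree+2≤n : (x : Fin n) → degree G x + 2 ≤ n
  degree+2≤n x with starRDF G x
  ... | f , f-rdf , w+deg≡n+1 = ≤-pred (begin
    suc (degree G x + 2)  ≡⟨ +-comm (suc (degree G x)) 2 ⟩
    3 + degree G x        ≤⟨ +-monoˡ-≤ (degree G x) (proj₂ γ≡3 f f-rdf) ⟩
    weight f + degree G x ≡⟨ w+deg≡n+1 ⟩
    suc n                 ∎)
    where open ≤-Reasoning

  nearUniversal : ∃ λ v → degree G v + 2 ≡ n
  nearUniversal with romanDomNumber≤3⇒∃nearUniversal G 4≤n γ≡3 ≤-refl
  ... | v , n≤deg+2 = v , ≤-antisym (degree+2≤n v) n≤deg+2

  NoNearUniversal : (Fin n → Fin n → Bool) → Set
  NoNearUniversal m = ∀ x → degreeWithout G m x + 2 < n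

  noNearUniversal⇒bondageSet : (E : EdgeSubset G) → NoNearUniversal (mem E) → IsRomanBondageSet G E
  noNearUniversal⇒bondageSet E low k k′ γG≡k γH≡k′ with k′ ≤? 3
  ... | no k′≰3 = subst (_< k′) (romanDomNumber-unique G γ≡3 γG≡k) (≰⇒> k′≰3)
  ... | yes k′≤3 with romanDomNumber≤3⇒∃nearUniversal (deleteEdges G E) 4≤n γH≡k′ k′≤3
  ...   | u , n≤deg+2 = ⊥-elim (<⇒≱ (low u) (subst (λ d → n ≤ d + 2) (degree-deleteEdges G E u) n≤deg+2))

  bondageSet⇒noNearUniversal : (E : EdgeSubset G) → IsRomanBondageSet G E → NoNearUniversal (mem E)
  bondageSet⇒noNearUniversal E bondage x with degreeWithout G (mem E) x + 2 <? n
  ... | yes low = low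
  ... | no ¬low with nearUniversal⇒romanDomNumber≤3 (deleteEdges G E) 4≤n x
                       (subst (λ d → n ≤ d + 2) (sym (degree-deleteEdges G E x)) (≮⇒≥ ¬low))
  ...   | k′ , γH≡k′ , k′≤3 = ⊥-elim (<⇒≱ (bondage 3 k′ γ≡3 γH≡k′) k′≤3)

  loses-edge⇒low : (m : Fin n → Fin n → Bool) {x y : Fin n} → m x y ≡ true → adj G x y ≡ true →
    degreeWithout G m x + 2 < n
  loses-edge⇒low m {x} mxy x~y = <-≤-trans (+-monoˡ-< 2 (degreeWithout<degree G m mxy x~y)) (degree+2≤n x)

  -- Stated for raw Boolean matrices, which can be enumerated, rather than for EdgeSubset.
  BondageMatrix : ℕ → (Fin n → Fin n → Bool) → Set
  BondageMatrix k m =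
    (∀ i j → m i j ≡ m j i) × (∀ i j → m i j ≡ true → adj G i j ≡ true) × NoNearUniversal m × pairCount m ≡ k

  bondageMatrix? : ∀ k → Decidable (BondageMatrix k)
  bondageMatrix? k m =
         all? (λ i → all? (λ j → m i j Bool.≟ m j i))
    ×-dec all? (λ i → all? (λ j → (m i j Bool.≟ true) →-dec (adj G i j Bool.≟ true)))
    ×-dec all? (λ x → degreeWithout G m x + 2 <? n)
    ×-dec (pairCount m ℕ.≟ k)

  bondageMatrix-resp : ∀ k → BondageMatrix k Respects (λ m m′ → ∀ i j → m i j ≡ m′ i j)
  bondageMatrix-resp k {m} {m′} m≗m′ (symm , ⊆adj , low , count) =
    (λ i j → trans (sym (m≗m′ i j)) (trans (symm i j) (m≗m′ j i))) ,
    (λ i j m′ij → ⊆adj i j (trans (m≗m′ i j) m′ij)) ,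
    (λ x → subst (λ d → d + 2 < n) (sum-cong-≗ (λ u → cong (λ b → b2n (adj G x u ∧ not b)) (m≗m′ x u))) (low x)) ,
    trans (sym (sum-cong-≗ (λ i → sum-cong-≗ (λ j → cong (λ b → when (toℕ i <ᵇ toℕ j) (b2n b)) (m≗m′ i j))))) count

  ∃bondageMatrix? : ∀ k → Dec (∃ (BondageMatrix k))
  ∃bondageMatrix? k = searchable-Fin→ (λ i → refl) (searchable-Fin→ refl searchable-Bool n) n
                        (BondageMatrix k) (bondageMatrix? k) (bondageMatrix-resp k)

  asMatrix : (E : EdgeSubset G) → NoNearUniversal (mem E) → ∃ (BondageMatrix (edgeCount E))
  asMatrix E low = mem E , memSym E , memSub E , low , sym (edgeCount≡pairCount E)

  bondageNumber-exists : (E : EdgeSubset G) → NoNearUniversal (mem E) →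
    ∃ λ b → IsRomanBondageNumber G b × b ≤ edgeCount E
  bondageNumber-exists E low with ∃-least ∃bondageMatrix? (asMatrix E low)
  ... | b , (m , symm , ⊆adj , low′ , count) , least =
    b , ((B , noNearUniversal⇒bondageSet B low′ , trans (edgeCount≡pairCount B) count) , minimal) , least (asMatrix E low)
    where
    B : EdgeSubset G
    B = record { mem = m ; memSym = symm ; memSub = ⊆adj }
    minimal : ∀ E′ → IsRomanBondageSet G E′ → b ≤ edgeCount E′
    minimal E′ bondage = least (asMatrix E′ (bondageSet⇒noNearUniversal E′ bondage))

  maxDegree≡n∸2 : {v : Fin n} → degree G v + 2 ≡ n → maxDegree G ≡ n ∸ 2
  maxDegree≡n∸2 {v} deg+2≡n = begin
    maxDegree G  ≡⟨ ≤-antisym (maxDegree-lub G deg≤deg-v) (degree≤maxDegree G v) ⟩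
    degree G v   ≡⟨ m+n∸n≡m (degree G v) 2 ⟨
    degree G v + 2 ∸ 2 ≡⟨ cong (_∸ 2) deg+2≡n ⟩
    n ∸ 2        ∎
    where
    open ≡-Reasoning
    deg≤deg-v : ∀ u → degree G u ≤ degree G v
    deg≤deg-v u = +-cancelʳ-≤ 2 _ _ (subst (degree G u + 2 ≤_) (sym deg+2≡n) (degree+2≤n u))

  module Construction {v : Fin n} (deg+2≡n : degree G v + 2 ≡ n) where

    nonNeighbour : ∃ λ w → w ≢ v × adj G v w ≡ false
    nonNeighbour with sum<n⇒∃≡0 (λ z → b2n (adj G v z) + δ v z) sum<n
      where
      sum<n : ∑[ z < n ] (b2n (adj G v z) + δ v z) < n
      sum<n = begin-strict
        ∑[ z < n ] (b2n (adj G v z) + δ v z)  ≡⟨ ∑-distrib-+ (λ z → b2n (adj G v z)) (δ v) ⟩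
        ∑[ z < n ] b2n (adj G v z) + sum (δ v) ≡⟨ cong₂ _+_ (sym (degree≡sum G v)) (sum-δ v) ⟩
        degree G v + 1                         <⟨ +-monoʳ-< (degree G v) (s≤s (s≤s z≤n)) ⟩
        degree G v + 2                         ≡⟨ deg+2≡n ⟩
        n                                      ∎
        where open ≤-Reasoning
    ... | w , eq with w ≟ v | adj G v w in v≁w
    ...   | no w≢v | false = w , w≢v , v≁w

    neighbour : ∃ λ a → adj G v a ≡ true
    neighbour with 0<sum⇒∃>0 (λ z → b2n (adj G v z)) 0<sum
      where
      2<deg+2 : 2 < degree G v + 2
      2<deg+2 = subst (2 <_) (sym deg+2≡n) (≤-trans (n≤1+n 3) 4≤n)
      0<sum : 0 < ∑[ z < n ] b2n (adj G v z)
      0<sum = subst (0 <_) (degree≡sum G v) (+-cancelʳ-< 2 0 (degree G v) 2<deg+2)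
    ... | a , 0<b2n with adj G v a in v~a
    ...   | true = a , v~a

    SmallBondageSet : Set
    SmallBondageSet = ∃ λ (E : EdgeSubset G) → NoNearUniversal (mem E) × edgeCount E ≤ degree G v

    module _ {w : Fin n} (w≢v : w ≢ v) (v≁w : adj G v w ≡ false) {a : Fin n} (v~a : adj G v a ≡ true) where

      adjacent-to-v : {x : Fin n} → x ≢ v → x ≢ w → adj G v x ≡ true
      adjacent-to-v {x} x≢v x≢w with adj G v x in v≁x
      ... | true  = refl
      ... | false = ⊥-elim (<-irrefl deg+2≡n (nonNeighbours⇒degree+2<n G (x≢w ∘ sym) (w≢v ∘ sym) (x≢v ∘ sym) v≁w v≁x))

      a≢v : a ≢ v
      a≢v refl = case trans (sym v~a) (irrefl G a) of λ ()

      a≢w : a ≢ w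
      a≢w refl = case trans (sym v~a) v≁w of λ ()

      -- If w and a are not adjacent, w has the three non-neighbours w, v, a and needs no deleted edge.
      deleteStar-v : adj G w a ≡ false → SmallBondageSet
      deleteStar-v w≁a = E , low , subst (_≤ degree G v) (sym (edgeCount≡pairCount E)) count
        where
        m : Fin n → Fin n → Bool
        m = star v (adj G v)
        E : EdgeSubset G
        E = record { mem = m ; memSym = star-sym v (adj G v) ; memSub = star-⊆ G v (adj G v) (λ _ v~j → v~j) }
        -- The tests are arguments rather than `with`-abstractions, which would also rewrite them inside m.
        low′ : ∀ x → Dec (x ≡ v) → Dec (x ≡ w) → degreeWithout G m x + 2 < n
        low′ _ (yes refl) _          = loses-edge⇒low m (star-centre v (adj G v) a v~a) v~a
        low′ _ (no _)     (yes refl) = ≤-<-trans (+-monoˡ-≤ 2 (degreeWithout≤degree G m w))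
                                     (nonNeighbours⇒degree+2<n G (a≢v ∘ sym) w≢v (a≢w ∘ sym) (trans (Graph.sym G w v) v≁w) w≁a)
        low′ x (no x≢v)   (no x≢w) = loses-edge⇒low m (star-leaf v (adj G v) x (adjacent-to-v x≢v x≢w))
                                     (trans (Graph.sym G x v) (adjacent-to-v x≢v x≢w))
        low : NoNearUniversal m
        low x = low′ x (x ≟ v) (x ≟ w)
        count : pairCount m ≤ degree G v
        count = subst (pairCount m ≤_) (sym (degree≡sum G v)) (pairCount-star v (adj G v))

      -- If w and a are adjacent, the edge va is spared and wa is deleted instead.
      deleteStar-v-swap : adj G w a ≡ true → SmallBondageSet
      deleteStar-v-swap w~a = E , low , subst (_≤ degree G v) (sym (edgeCount≡pairCount E)) count
        where
        p : Fin n → Bool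
        p j = adj G v j ∧ not (does (j ≟ a))
        ⁅a⁆ : Fin n → Bool
        ⁅a⁆ j = does (j ≟ a)
        m : Fin n → Fin n → Bool
        m i j = star v p i j ∨ star w ⁅a⁆ i j
        p⊆N[v] : ∀ j → p j ≡ true → adj G v j ≡ true
        p⊆N[v] j pj with adj G v j
        ... | true = refl
        ⁅a⁆⊆N[w] : ∀ j → ⁅a⁆ j ≡ true → adj G w j ≡ true
        ⁅a⁆⊆N[w] j j≡a with j ≟ a
        ... | yes refl = w~a
        m⊆adj : ∀ i j → m i j ≡ true → adj G i j ≡ true
        m⊆adj i j ij∈m with star v p i j in ij∈star-v
        ... | true  = star-⊆ G v p p⊆N[v] i j ij∈star-v
        ... | false = star-⊆ G w ⁅a⁆ ⁅a⁆⊆N[w] i j ij∈m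
        E : EdgeSubset G
        E = record { mem = m ; memSym = λ i j → cong₂ _∨_ (star-sym v p i j) (star-sym w ⁅a⁆ i j) ; memSub = m⊆adj }
        a∈⁅a⁆ : ⁅a⁆ a ≡ true
        a∈⁅a⁆ = dec-true (a ≟ a) refl
        only-a-remains : ∀ u → b2n (adj G v u ∧ not (m v u)) ≤ δ a u
        only-a-remains u with u ≟ a | adj G v u
        ... | yes _ | _     = b2n≤1 _
        ... | no _  | false = z≤n
        ... | no _  | true rewrite dec-true (v ≟ v) refl = z≤n
        low′ : ∀ x → Dec (x ≡ v) → Dec (x ≡ w) → Dec (x ≡ a) → degreeWithout G m x + 2 < n
        low′ _ (yes refl) _ _ = ≤-trans (s≤s (+-monoˡ-≤ 2 (subst (degreeWithout G m v ≤_) (sum-δ a) (sum-mono-≤ only-a-remains)))) 4≤n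
        low′ _ (no _) (yes refl) _ = loses-edge⇒low m (∨-introʳ (star v p w a) (star-centre w ⁅a⁆ a a∈⁅a⁆)) w~a
        low′ _ (no _) (no _) (yes refl) = loses-edge⇒low m (∨-introʳ (star v p a w) (star-leaf w ⁅a⁆ a a∈⁅a⁆)) (trans (Graph.sym G a w) w~a)
        low′ x (no x≢v) (no x≢w) (no x≢a) = loses-edge⇒low m (∨-introˡ (star w ⁅a⁆ x v) (star-leaf v p x px)) (trans (Graph.sym G x v) (adjacent-to-v x≢v x≢w))
          where
          px : p x ≡ true
          px rewrite adjacent-to-v x≢v x≢w | dec-false (x ≟ a) x≢a = refl
        low : NoNearUniversal m
        low x = low′ x (x ≟ v) (x ≟ w) (x ≟ a)
        p+⁅a⁆≡N[v] : ∀ x → b2n (p x) + b2n (⁅a⁆ x) ≡ b2n (adj G v x)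
        p+⁅a⁆≡N[v] x with x ≟ a
        ... | yes refl rewrite v~a = refl
        ... | no _ = trans (+-identityʳ _) (cong b2n (∧-identityʳ (adj G v x)))
        count : pairCount m ≤ degree G v
        count = begin
          pairCount m                                            ≤⟨ pairCount-∨ (star v p) (star w ⁅a⁆) ⟩
          pairCount (star v p) + pairCount (star w ⁅a⁆)          ≤⟨ +-mono-≤ (pairCount-star v p) (pairCount-star w ⁅a⁆) ⟩
          ∑[ x < n ] b2n (p x) + ∑[ x < n ] b2n (⁅a⁆ x)          ≡⟨ ∑-distrib-+ (λ x → b2n (p x)) (λ x → b2n (⁅a⁆ x)) ⟨
          ∑[ x < n ] (b2n (p x) + b2n (⁅a⁆ x))                   ≡⟨ sum-cong-≗ p+⁅a⁆≡N[v] ⟩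
          ∑[ x < n ] b2n (adj G v x)                             ≡⟨ degree≡sum G v ⟨
          degree G v                                             ∎
          where open ≤-Reasoning

    smallBondageSet : SmallBondageSet
    smallBondageSet with nonNeighbour | neighbour
    ... | w , w≢v , v≁w | a , v~a with adj G w a in w~a
    ...   | true  = deleteStar-v-swap w≢v v≁w v~a w~a
    ...   | false = deleteStar-v w≢v v≁w v~a w~a

theorem11 : ∀ (n : ℕ) (G : Graph n) → 4 ≤ n → Connected G → IsRomanDomNumber G 3 →
    (∃ λ b → IsRomanBondageNumber G b × b ≤ maxDegree G) × (maxDegree G ≡ n ∸ 2)
theorem11 n G 4≤n _ γ≡3 = (b , isBondageNumber , b≤Δ) , Δ≡n∸2
  where
  open Bondage G 4≤n γ≡3
  v = proj₁ nearUniversal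
  deg+2≡n = proj₂ nearUniversal
  open Construction deg+2≡n using (smallBondageSet)
  E = proj₁ smallBondageSet
  bondageNumber = bondageNumber-exists E (proj₁ (proj₂ smallBondageSet))
  b = proj₁ bondageNumber
  isBondageNumber = proj₁ (proj₂ bondageNumber)
  Δ≡n∸2 : maxDegree G ≡ n ∸ 2
  Δ≡n∸2 = maxDegree≡n∸2 deg+2≡n
  b≤Δ : b ≤ maxDegree G
  b≤Δ = begin
    b             ≤⟨ proj₂ (proj₂ bondageNumber) ⟩
    edgeCount E   ≤⟨ proj₂ (proj₂ smallBondageSet) ⟩
    degree G v    ≤⟨ degree≤maxDegree G v ⟩
    maxDegree G   ∎
    where open ≤-Reasoning
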